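{- Let $a,b$ be coprime positive integers with $a>1$, let $k$ be the number of distinct prime factors of $a$, and let $z$ be an integer. Define $s_n=z-b-ab-\cdots-a^{n-1}b=z-b\cdot\frac{a^n-1}{a-1}$ for $n\ge 1$. If $z>b+ab+a^2b+\cdots+a^{k+1}b$, then there exists a prime $p$ with $p\nmid a$ such that $p\mid s_i$ for some index $i$ with $1\le i\le k+1$.
   Context: The sequence $(s_n)_{n\ge1}$ can equivalently be defined by $s_1=z-b$ and $s_{n+1}=s_n-a^nb$. -}

module Defs where

open import Data.Nat as ℕ using (ℕ; zero; suc)
open import Data.Nat.Primality using (Prime; prime?)
open import Data.Nat.Divisibility using (_∣?_)
open import Data.List using (List; filter; upTo; length)
open import Data.Integer as ℤ using (ℤ; +_)
open import Relation.Nullary.Decidable using (_×-dec_)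

-- ω a : the number of distinct prime factors of a, computed as the number of
-- p ∈ {0, …, a} that are prime and divide a (for a ≥ 1 every prime divisor is ≤ a).
ω : ℕ → ℕ
ω a = length (filter (λ p → prime? p ×-dec (p ∣? a)) (upTo (suc a)))

geomSum : ℕ → ℕ → ℕ → ℕ
geomSum a b zero = 0
geomSum a b (suc n) = geomSum a b n ℕ.+ a ℕ.^ n ℕ.* b

s : ℕ → ℕ → ℤ → ℕ → ℤ
s a b z n = z ℤ.- + geomSum a b n

-- If every s_i (1 ≤ i ≤ k+1) had only prime factors dividing a, then, being larger than
-- a^(k+1), each s_i would contain some prime p ∣ a to a higher power than a^(k+1) does.
-- There are only k such primes, so two of them, s_i and s_j with i < j, share one, p say.
-- But s_i − s_j = a^i (b + ab + ⋯ + a^(j−i−1) b), whose second factor is ≡ b (mod p) and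
-- hence prime to p; so p divides the difference exactly as often as it divides a^i, which
-- is less often than it divides both s_i and s_j.
module Submission where

open import Defs
open import Data.Nat
open import Data.Nat.Properties
open import Data.Nat.Divisibility
open import Data.Nat.Primality
open import Data.Nat.Coprimality using (Coprime)
open import Data.Nat.ListAction using (product)
open import Data.Nat.Primality.Factorisation using (factorise)
open import Data.Nat.Solver using (module +-*-Solver)
open import Data.Integer using (ℤ; +_; -[1+_]; +<+)
import Data.Integer.Properties as ℤP
open import Data.Fin using (Fin; toℕ; zero; suc)
open import Data.Fin.Properties using (pigeonhole; toℕ<n)
open import Data.List using (List; []; _∷_; filter; upTo; lookup)
open import Data.List.Membership.Propositional using (_∈_)
open import Data.List.Membership.Propositional.Properties using (∈-filter⁺; ∈-upTo⁺)
open import Data.List.Relation.Unary.All using (All; []; _∷_)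
open import Data.List.Relation.Unary.Any using (index)
open import Data.List.Relation.Unary.Any.Properties using (lookup-index)
open import Data.Product using (Σ; _×_; _,_; proj₁; ∃; ∃₂; ∃-syntax)
open import Data.Sum using (_⊎_; inj₁; inj₂; [_,_]′)
open import Data.Empty using (⊥; ⊥-elim)
open import Relation.Nullary using (¬_; yes; no)
open import Relation.Nullary.Decidable using (_×-dec_)
open import Relation.Binary.PropositionalEquality
import Data.Nat.Divisibility as ℕD
import Data.Integer.Divisibility as ℤD
import Data.Integer as ℤ

open +-*-Solver

geomSum-+ : ∀ a b m n → geomSum a b (m + n) ≡ geomSum a b m + a ^ m * geomSum a b n
geomSum-+ a b m zero rewrite +-identityʳ m | *-zeroʳ (a ^ m) = sym (+-identityʳ _)
geomSum-+ a b m (suc n) rewrite +-suc m n | geomSum-+ a b m n | ^-distribˡ-+-* a m n =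
  solve 5 (λ g x y h b → g :+ x :* h :+ x :* y :* b := g :+ x :* (h :+ y :* b)) refl
    (geomSum a b m) (a ^ m) (a ^ n) (geomSum a b n) b

geomSum-suc : ∀ a b n → geomSum a b (suc n) ≡ a * geomSum a b n + b
geomSum-suc a b zero rewrite *-zeroʳ a = +-identityʳ b
geomSum-suc a b (suc n) = trans (cong (_+ a ^ suc n * b) (geomSum-suc a b n)) (
  solve 4 (λ a g x b → a :* g :+ b :+ a :* x :* b := a :* (g :+ x :* b) :+ b) refl
    a (geomSum a b n) (a ^ n) b)

geomSum-mono-≤ : ∀ a b {m n} → m ≤ n → geomSum a b m ≤ geomSum a b n
geomSum-mono-≤ a b {m} m≤n with m≤n⇒∃[o]m+o≡n m≤n
... | o , refl rewrite geomSum-+ a b m o = m≤m+n _ _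

prime∤geomSum : ∀ {a b p} n → Coprime a b → Prime p → p ∣ a → ¬ p ∣ geomSum a b (suc n)
prime∤geomSum {a} {b} {p} n coprime pp p∣a p∣sum = ¬prime[1] (subst Prime (coprime (p∣a , p∣b)) pp)
  where
  p∣b : p ∣ b
  p∣b = ∣m+n∣m⇒∣n (subst (p ∣_) (geomSum-suc a b n) p∣sum) (∣-trans p∣a (m∣m*n _))

^-monoʳ-∣ : ∀ m {i j} → i ≤ j → m ^ i ∣ m ^ j
^-monoʳ-∣ m {i} i≤j with m≤n⇒∃[o]m+o≡n i≤j
... | o , refl = subst (m ^ i ∣_) (sym (^-distribˡ-+-* m i o)) (m∣m*n (m ^ o))

n<m^n : ∀ {m} → 1 < m → ∀ n → n < m ^ n
n<m^n 1<m zero = z<s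
n<m^n {m} 1<m (suc n) = begin-strict
  suc n          ≤⟨ n<m^n 1<m n ⟩
  m ^ n          <⟨ m<m+n (m ^ n) (≤-trans z<s (n<m^n 1<m n)) ⟩
  m ^ n + m ^ n  ≡⟨ cong (_+_ (m ^ n)) (sym (+-identityʳ (m ^ n))) ⟩
  2 * m ^ n      ≤⟨ *-monoˡ-≤ (m ^ n) 1<m ⟩
  m * m ^ n      ∎
  where open ≤-Reasoning

prime^∣-cancelˡ : ∀ {p x} → Prime p → ¬ p ∣ x → ∀ e {y} → p ^ e ∣ x * y → p ^ e ∣ y
prime^∣-cancelˡ pp p∤x zero {y} _ = 1∣ y
prime^∣-cancelˡ {p} {x} pp p∤x (suc e) p^e∣xy with euclidsLemma x _ pp (∣-trans (m∣m*n (p ^ e)) p^e∣xy)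
... | inj₁ p∣x = ⊥-elim (p∤x p∣x)
... | inj₂ (divides y refl) = subst (p ^ suc e ∣_) (*-comm p y) (*-monoʳ-∣ p p^e∣y)
  where
  instance _ = prime⇒nonZero pp
  p^e∣y : p ^ e ∣ y
  p^e∣y = prime^∣-cancelˡ pp p∤x e (*-cancelˡ-∣ p
    (subst (p * p ^ e ∣_) (solve 3 (λ x y p → x :* (y :* p) := p :* (x :* y)) refl x y p) p^e∣xy))

-- ValuationLess p m n says v_p(m) < v_p(n) without valuations; it holds for every m when n = 0.
ValuationLess : ℕ → ℕ → ℕ → Set
ValuationLess p m n = ∀ e → p ^ e ∣ m → p ^ suc e ∣ n

valuationLess⇒∤ : ∀ {p m n} → Prime p → .{{NonZero n}} → ValuationLess p m n → ¬ n ∣ m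
valuationLess⇒∤ {p} {m} {n} pp v< n∣m =
  <⇒≱ (n<m^n (nonTrivial⇒n>1 p {{prime⇒nonTrivial pp}}) n) (∣⇒≤ (p^e∣n n))
  where
  p^e∣n : ∀ e → p ^ e ∣ n
  p^e∣n zero = 1∣ n
  p^e∣n (suc e) = v< e (∣-trans (p^e∣n e) n∣m)

valuationLess-+-cancelˡ : ∀ {p m n d} → ValuationLess p m (n + d) → ValuationLess p m n → ValuationLess p m d
valuationLess-+-cancelˡ v<n+d v<n e p^e∣m = ∣m+n∣m⇒∣n (v<n+d e p^e∣m) (v<n e p^e∣m)

valuationLess-cancelˡ : ∀ {p m x y} → Prime p → ¬ p ∣ x →
  ValuationLess p m (x * y) → ValuationLess p m y
valuationLess-cancelˡ pp p∤x v< e p^e∣m = prime^∣-cancelˡ pp p∤x (suc e) (v< e p^e∣m)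

valuationLess-∤ : ∀ {p m} → ¬ p ∣ m → ∀ n → ValuationLess p m (p * n)
valuationLess-∤ {p} p∤m n zero _ = *-monoʳ-∣ p (1∣ n)
valuationLess-∤ p∤m n (suc e) p^e∣m = ⊥-elim (p∤m (∣-trans (m∣m*n _) p^e∣m))

valuationLess-*ˡ : ∀ {q p m n} → Prime q → Prime p →
  ValuationLess q m n → ValuationLess q (p * m) (p * n)
valuationLess-*ˡ {q} {p} qp pp v< with q ∣? p
... | no q∤p = λ e q^e∣pm → ∣-trans (v< e (prime^∣-cancelˡ qp q∤p e q^e∣pm)) (n∣m*n p)
... | yes q∣p with prime⇒irreducible pp q∣p
...   | inj₁ refl = ⊥-elim (¬prime[1] qp)
...   | inj₂ refl = λ where
  zero _ → *-monoʳ-∣ q (1∣ _)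
  (suc e) q^e∣qm → *-monoʳ-∣ q (v< e (*-cancelˡ-∣ q {{prime⇒nonZero qp}} q^e∣qm))

product∣⊎valuationLess : ∀ {ps} → All Prime ps → ∀ m →
  product ps ∣ m ⊎ ∃[ q ] Prime q × q ∣ product ps × ValuationLess q m (product ps)
product∣⊎valuationLess [] m = inj₁ (1∣ m)
product∣⊎valuationLess {p ∷ ps} (pp ∷ pps) m with p ∣? m
... | no p∤m = inj₂ (p , pp , m∣m*n _ , valuationLess-∤ p∤m _)
... | yes (divides m′ refl) with product∣⊎valuationLess pps m′
...   | inj₁ ps∣m′ = inj₁ (subst (p * product ps ∣_) (*-comm p m′) (*-monoʳ-∣ p ps∣m′))
...   | inj₂ (q , qp , q∣ps , v<) = inj₂ (q , qp , ∣-trans q∣ps (n∣m*n p) ,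
          subst (λ x → ValuationLess q x (p * product ps)) (*-comm p m′) (valuationLess-*ˡ qp pp v<))

∤⇒valuationLess : ∀ {n m} → .{{NonZero n}} → ¬ n ∣ m → ∃[ q ] Prime q × q ∣ n × ValuationLess q m n
∤⇒valuationLess {n} {m} n∤m with factorise n
... | record { factors = ps ; isFactorisation = refl ; factorsPrime = pps }
    with product∣⊎valuationLess pps m
...   | inj₁ ps∣m = ⊥-elim (n∤m ps∣m)
...   | inj₂ excess = excess

some⊎all : ∀ {n} {A B : Fin n → Set} → (∀ i → A i ⊎ B i) → ∃ A ⊎ (∀ i → B i)
some⊎all {zero} _ = inj₂ λ ()
some⊎all {suc n} f with f zero | some⊎all (λ i → f (suc i))
... | inj₁ x | _ = inj₁ (zero , x)
... | inj₂ _ | inj₁ (i , x) = inj₁ (suc i , x)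
... | inj₂ y | inj₂ ys = inj₂ λ where
  zero → y
  (suc i) → ys i

primeDivisors : ℕ → List ℕ
primeDivisors a = filter (λ p → prime? p ×-dec (p ∣? a)) (upTo (suc a))

∈-primeDivisors : ∀ {a p} → .{{NonZero a}} → Prime p → p ∣ a → p ∈ primeDivisors a
∈-primeDivisors {a} pp p∣a =
  ∈-filter⁺ (λ p → prime? p ×-dec (p ∣? a)) (∈-upTo⁺ (s≤s (∣⇒≤ p∣a))) (pp , p∣a)

-- tail i is the paper's s_i; for i ≤ K the hypothesis on Z keeps the truncated subtraction exact.
module Tails (a b K Z : ℕ) .{{_ : NonZero a}} .{{_ : NonZero b}} (large : geomSum a b (suc K) < Z) where

  tail : ℕ → ℕ
  tail i = Z ∸ geomSum a b i

  geomSum≤Z : ∀ {i} → i ≤ K → geomSum a b i ≤ Z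
  geomSum≤Z i≤K = ≤-trans (geomSum-mono-≤ a b (m≤n⇒m≤1+n i≤K)) (<⇒≤ large)

  tail+geomSum≡Z : ∀ {i} → i ≤ K → tail i + geomSum a b i ≡ Z
  tail+geomSum≡Z i≤K = m∸n+n≡m (geomSum≤Z i≤K)

  ∣s∣≡tail : ∀ {i} → i ≤ K → ℤ.∣ s a b (+ Z) i ∣ ≡ tail i
  ∣s∣≡tail {i} i≤K =
    cong ℤ.∣_∣ (trans (ℤP.[+m]-[+n]≡m⊖n Z (geomSum a b i)) (ℤP.⊖-≥ (geomSum≤Z i≤K)))

  a^K<tail : ∀ {i} → i ≤ K → a ^ K < tail i
  a^K<tail {i} i≤K = +-cancelʳ-< (geomSum a b i) (a ^ K) (tail i) (begin-strict
    a ^ K + geomSum a b i      ≤⟨ +-mono-≤ (m≤m*n (a ^ K) b) (geomSum-mono-≤ a b i≤K) ⟩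
    a ^ K * b + geomSum a b K  ≡⟨ +-comm (a ^ K * b) _ ⟩
    geomSum a b (suc K)        <⟨ large ⟩
    Z                          ≡⟨ tail+geomSum≡Z i≤K ⟨
    tail i + geomSum a b i     ∎)
    where open ≤-Reasoning

  tail∤a^K : ∀ {i} → i ≤ K → ¬ tail i ∣ a ^ K
  tail∤a^K i≤K tail∣a^K = <⇒≱ (a^K<tail i≤K) (∣⇒≤ {{m^n≢0 a K}} tail∣a^K)

  tail-split : ∀ {i j} d → i + d ≡ j → j ≤ K → tail i ≡ tail j + a ^ i * geomSum a b d
  tail-split {i} d refl j≤K = +-cancelʳ-≡ (geomSum a b i) _ _ (begin
    tail i + geomSum a b i                                ≡⟨ tail+geomSum≡Z (≤-trans (m≤m+n i d) j≤K) ⟩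
    Z                                                     ≡⟨ tail+geomSum≡Z j≤K ⟨
    tail (i + d) + geomSum a b (i + d)                    ≡⟨ cong (_+_ (tail (i + d))) (geomSum-+ a b i d) ⟩
    tail (i + d) + (geomSum a b i + a ^ i * geomSum a b d) ≡⟨ solve 3 (λ t g x → t :+ (g :+ x) := t :+ x :+ g) refl
                                                                (tail (i + d)) (geomSum a b i) (a ^ i * geomSum a b d) ⟩
    tail (i + d) + a ^ i * geomSum a b d + geomSum a b i  ∎)
    where open ≡-Reasoning

  no-shared-excess : Coprime a b → ∀ {p i j} → Prime p → p ∣ a → i < j → j ≤ K →
    ValuationLess p (a ^ K) (tail i) → ValuationLess p (a ^ K) (tail j) → ⊥
  no-shared-excess coprime {p} {i} pp p∣a i<j j≤K v<i v<j with m≤n⇒∃[o]m+o≡n i<j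
  ... | d , 1+i+d≡j = valuationLess⇒∤ pp {{m^n≢0 a i}} v<a^i (^-monoʳ-∣ a (≤-trans (n≤1+n i) (≤-trans i<j j≤K)))
    where
    v<difference : ValuationLess p (a ^ K) (a ^ i * geomSum a b (suc d))
    v<difference = valuationLess-+-cancelˡ
      (subst (ValuationLess p (a ^ K)) (tail-split (suc d) (trans (+-suc i d) 1+i+d≡j) j≤K) v<i) v<j
    v<a^i : ValuationLess p (a ^ K) (a ^ i)
    v<a^i = valuationLess-cancelˡ pp (prime∤geomSum d coprime pp p∣a)
      (subst (ValuationLess p (a ^ K)) (*-comm (a ^ i) _) v<difference)

  CoprimeFactor : ℕ → Set
  CoprimeFactor i = ∃[ p ] Prime p × ¬ p ∣ a × p ∣ tail i

  ExcessFactor : ℕ → Set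
  ExcessFactor i = ∃[ p ] Prime p × p ∣ a × ValuationLess p (a ^ K) (tail i)

  coprimeFactor⊎excessFactor : ∀ {i} → i ≤ K → CoprimeFactor i ⊎ ExcessFactor i
  coprimeFactor⊎excessFactor {i} i≤K
    with ∤⇒valuationLess {{>-nonZero (≤-<-trans z≤n (a^K<tail i≤K))}} (tail∤a^K i≤K)
  ... | p , pp , p∣tail , v< with p ∣? a
  ...   | no p∤a = inj₁ (p , pp , p∤a , p∣tail)
  ...   | yes p∣a = inj₂ (p , pp , p∣a , v<)

  ¬all-excess : Coprime a b → ω a < K → ¬ (∀ (i : Fin K) → ExcessFactor (suc (toℕ i)))
  ¬all-excess coprime ω<K excess = clash (pigeonhole ω<K slot)
    where
    slot : Fin K → Fin (ω a)
    slot i = let _ , pp , p∣a , _ = excess i in index (∈-primeDivisors pp p∣a)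
    slot-prime : ∀ i → proj₁ (excess i) ≡ lookup (primeDivisors a) (slot i)
    slot-prime i = let _ , pp , p∣a , _ = excess i in lookup-index (∈-primeDivisors pp p∣a)
    clash : ∃₂ (λ i j → toℕ i < toℕ j × slot i ≡ slot j) → ⊥
    clash (i , j , i<j , same) =
      let p , pp , p∣a , v<i = excess i
          _ , _ , _ , v<j = excess j
          same-prime = trans (slot-prime i) (trans (cong (lookup (primeDivisors a)) same) (sym (slot-prime j)))
      in no-shared-excess coprime pp p∣a (s<s i<j) (toℕ<n j)
           v<i (subst (λ q → ValuationLess q (a ^ K) (tail (suc (toℕ j)))) (sym same-prime) v<j)

lemma1 : (a b : ℕ) → 0 < b → 1 < a → Coprime a b → (z : ℤ)
    → + geomSum a b (suc (suc (ω a))) ℤ.< z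
    → Σ ℕ (λ p → Prime p × ¬ (p ℕD.∣ a)
        × Σ ℕ (λ i → 1 ≤ i × i ≤ suc (ω a) × (+ p) ℤD.∣ s a b z i))
lemma1 a b 0<b 1<a coprime -[1+ _ ] ()
lemma1 a b 0<b 1<a coprime (+ Z) (+<+ large) =
  [ witness , (λ excess → ⊥-elim (¬all-excess coprime ≤-refl excess)) ]′
    (some⊎all (λ i → coprimeFactor⊎excessFactor (toℕ<n i)))
  where
  instance
    _ = >-nonZero (<-trans z<s 1<a)
    _ = >-nonZero 0<b
  open Tails a b (suc (ω a)) Z large
  witness : ∃ (λ (i : Fin (suc (ω a))) → CoprimeFactor (suc (toℕ i))) →
    Σ ℕ (λ p → Prime p × ¬ (p ℕD.∣ a) × Σ ℕ (λ i → 1 ≤ i × i ≤ suc (ω a) × (+ p) ℤD.∣ s a b (+ Z) i))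
  witness (i , p , pp , p∤a , p∣tail) =
    p , pp , p∤a , suc (toℕ i) , s≤s z≤n , toℕ<n i , subst (p ∣_) (sym (∣s∣≡tail (toℕ<n i))) p∣tail
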